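{- Let $G=(V,E)$ be a connected block graph. Then $rad(G)\leq \frac{3}{2}\cdot dc(G)+1$.
   Context: All graphs are finite, simple and undirected. A block of a graph is a maximal 2-connected subgraph; $G$ is a block graph if every block of $G$ is a complete graph (clique). $rad(G)=\min_{u\in V}\max_{v\in V} d(u,v)$ is the radius of the connected graph $G$, where $d$ is the shortest-path distance. A cluster graph is a disjoint union of complete graphs; the distance to cluster $dc(G)$ is the minimum number of vertices of $G$ whose removal yields a cluster graph. -}

module Defs where

open import Data.Nat using (ℕ; zero; suc; _≤_)
open import Data.Fin using (Fin)
open import Data.Fin.Subset using (Subset; _∈_; _∉_; ∣_∣; _⊆_)
open import Data.Product using (Σ; ∃; _×_)
open import Relation.Binary.PropositionalEquality using (_≡_; _≢_)
open import Relation.Nullary using (¬_)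
open import Level using (0ℓ; suc)

record Graph (n : ℕ) : Set₁ where
  field
    Adj     : Fin n → Fin n → Set
    sym     : ∀ {u v} → Adj u v → Adj v u
    irrefl  : ∀ {u} → ¬ Adj u u
open Graph public

module _ {n : ℕ} (G : Graph n) where

  data Walk : Fin n → Fin n → ℕ → Set where
    here : ∀ {u} → Walk u u 0
    step : ∀ {u w v k} → Adj G u w → Walk w v k → Walk u v (ℕ.suc k)

  data WalkIn (P : Fin n → Set) : Fin n → Fin n → Set where
    here : ∀ {u} → P u → WalkIn P u u
    step : ∀ {u w v} → P u → Adj G u w → WalkIn P w v → WalkIn P u v

  Connected : Set
  Connected = ∀ u v → ∃ λ k → Walk u v k

  Dist : Fin n → Fin n → ℕ → Set
  Dist u v d = Walk u v d × (∀ m → Walk u v m → d ≤ m)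

  Ecc : Fin n → ℕ → Set
  Ecc u e = (∀ v → ∃ λ d → Dist u v d × d ≤ e) × (∃ λ v → Dist u v e)

  Radius : ℕ → Set
  Radius r = (∃ λ u → Ecc u r) × (∀ u e → Ecc u e → r ≤ e)

  ConnectedIn : (Fin n → Set) → Set
  ConnectedIn P = ∀ u v → P u → P v → WalkIn P u v

  NonSeparable : Subset n → Set
  NonSeparable B =
    ConnectedIn (λ x → x ∈ B) ×
    (∀ w → w ∈ B → ConnectedIn (λ x → x ∈ B × x ≢ w))

  Block : Subset n → Set
  Block B = NonSeparable B × (∀ B′ → B ⊆ B′ → NonSeparable B′ → B′ ⊆ B)

  BlockGraph : Set
  BlockGraph = ∀ B → Block B → ∀ x y → x ∈ B → y ∈ B → x ≢ y → Adj G x y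

  -- G - S is a cluster graph: every connected component of G - S is complete
  ClusterDeletion : Subset n → Set
  ClusterDeletion S =
    ∀ x y → x ∉ S → y ∉ S → x ≢ y → WalkIn (λ z → z ∉ S) x y → Adj G x y

  DistToCluster : ℕ → Set
  DistToCluster k =
    (∃ λ S → ClusterDeletion S × ∣ S ∣ ≡ k) ×
    (∀ S → ClusterDeletion S → k ≤ ∣ S ∣)

module Submission where

-- Let S be a cluster deletion set. On a shortest path, no three consecutive vertices avoid S, for
-- they would induce a P₃ in the cluster graph G - S; hence every distance is at most 3|S| + 1.
-- In a block graph, let c be a middle vertex of a diametral path a ⇝ x c y ⇝ b. If some v were
-- farther from c than ⌈diam/2⌉, the shortest paths from v to a and to b would avoid c, giving an
-- x–y path avoiding c; together with c it spans a 2-connected set, which lies in a clique block, so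
-- x and y would be adjacent and a ⇝ b could be shortened. Thus 2·rad ≤ diam + 1 ≤ 3·dc + 2.
-- Adjacency is not decidable here, so distances and blocks exist only under double negation; the
-- goal is a decidable inequality, so that suffices.

open import Defs
open import Data.Fin using (Fin; _≟_)
open import Data.Fin.Properties using (sequence)
open import Data.Fin.Subset using (Subset; _∈_; _⊆_; _⊂_; _⊃_; ∣_∣; ⁅_⁆; _∪_) renaming (⊥ to ∅)
open import Data.Fin.Subset.Induction using (⊃-wellFounded)
open import Data.Fin.Subset.Properties
  using (_∈?_; ∉⊥; x∈⁅x⁆; x∈⁅y⁆⇒x≡y; ∣⁅x⁆∣≡1; x∈p∪q⁻; x∈p∪q⁺; q⊆p∪q; p⊂q⇒∣p∣<∣q∣; p⊆q⇒∣p∣≤∣q∣)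
open import Data.List using (List; []; _∷_; allFin)
open import Data.List.Extrema.Nat using (argmax; f[xs]≤f[argmax])
open import Data.List.Membership.Propositional using () renaming (_∈_ to _∈ₗ_; _∉_ to _∉ₗ_)
open import Data.List.Membership.Propositional.Properties using (∈-allFin)
open import Data.List.Relation.Binary.Subset.Propositional using () renaming (_⊆_ to _⊆ₗ_)
import Data.List.Relation.Unary.All as List
open import Data.List.Relation.Unary.Any using (here; there; any?)
open import Data.Nat using (ℕ; zero; suc; _≤_; _<_; _+_; _*_; z≤n; s≤s; _≤?_; ⌊_/2⌋; ⌈_/2⌉)
open import Data.Nat.Induction using (<-rec)
open import Data.Nat.Properties
  using ( ≤-refl; ≤-reflexive; ≤-trans; ≤-antisym; ≤-pred; <-≤-trans; ≮⇒≥; <⇒≱; ≰⇒>; 1+n≰n; n≤1+n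
        ; m≤n⇒m≤1+n; m≤m+n; m≤n+m; +-comm; +-suc; +-identityʳ; +-mono-≤; +-monoˡ-≤; +-monoʳ-≤
        ; +-monoˡ-<; +-monoʳ-<; +-cancelˡ-≤; +-cancelʳ-≤; *-suc; *-monoʳ-≤
        ; ⌊n/2⌋+⌈n/2⌉≡n; ⌊n/2⌋≤⌈n/2⌉; ⌈n/2⌉-mono; module ≤-Reasoning )
open import Data.Product using (∃; ∃₂; _×_; _,_; proj₁; proj₂; map₁)
open import Data.Sum using (_⊎_; inj₁; inj₂)
open import Data.Vec using (tabulate)
open import Data.Vec.Properties using (lookup∘tabulate; []=⇒lookup; lookup⇒[]=)
open import Effect.Monad using (RawMonad)
open import Function using (_∘_; id)
import Induction.WellFounded as WF
open import Level using (0ℓ)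
open import Relation.Binary.PropositionalEquality
  using (_≡_; _≢_; refl; cong; subst; trans; ≢-sym) renaming (sym to ≡-sym)
open import Relation.Nullary using (¬_; Dec; yes; no; does)
open import Relation.Nullary.Decidable using (dec-true; decidable-stable)
open import Relation.Nullary.Negation using (¬¬-Monad; ¬¬-map; contradiction)

private
  variable
    n i j k l : ℕ

open RawMonad (¬¬-Monad {a = 0ℓ}) using (_<$>_; rawApplicative)

¬¬-least : {Q : ℕ → Set} → Q k → ¬ ¬ (∃ λ j → Q j × (∀ i → Q i → j ≤ i))
¬¬-least {Q = Q} q none = <-rec (λ m → ¬ Q m) noLeast _ q
  where
  noLeast : ∀ m → (∀ {i} → i < m → ¬ Q i) → ¬ Q m
  noLeast m below qm = none (m , qm , λ i qi → ≮⇒≥ λ i<m → below i<m qi)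

¬¬-∀ : {P : Fin n → Set} → (∀ i → ¬ ¬ P i) → ¬ ¬ (∀ i → P i)
¬¬-∀ = sequence rawApplicative

argmaxᶠ : (Fin n → ℕ) → Fin n → Fin n
argmaxᶠ f x = argmax f x (allFin _)

f≤f[argmaxᶠ] : ∀ (f : Fin n → ℕ) x y → f y ≤ f (argmaxᶠ f x)
f≤f[argmaxᶠ] f x y = List.lookup (f[xs]≤f[argmax] x (allFin _)) (∈-allFin y)

halve : ∀ m → ∃₂ λ i j → i + j ≡ m × i ≤ j × j ≤ suc i
halve m = ⌊ m /2⌋ , ⌈ m /2⌉ , ⌊n/2⌋+⌈n/2⌉≡n m , ⌊n/2⌋≤⌈n/2⌉ m , ⌈n/2⌉-mono (n≤1+n m)

twice≤suc : ∀ {d D} → d ≤ D → D ≤ 1 → 2 * d ≤ suc D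
twice≤suc z≤n _ = z≤n
twice≤suc (s≤s z≤n) (s≤s z≤n) = s≤s (s≤s z≤n)

_∈ₗ?_ : ∀ {n} (z : Fin n) xs → Dec (z ∈ₗ xs)
z ∈ₗ? xs = any? (z ≟_) xs

fromList : ∀ {n} → List (Fin n) → Subset n
fromList xs = tabulate λ z → does (z ∈ₗ? xs)

module _ {n : ℕ} (xs : List (Fin n)) {z : Fin n} where

  ∈-fromList⁺ : z ∈ₗ xs → z ∈ fromList xs
  ∈-fromList⁺ z∈xs = lookup⇒[]= z _ (trans (lookup∘tabulate _ z) (dec-true (z ∈ₗ? xs) z∈xs))

  ∈-fromList⁻ : z ∈ fromList xs → z ∈ₗ xs
  ∈-fromList⁻ z∈ with z ∈ₗ? xs | lookup∘tabulate (λ t → does (t ∈ₗ? xs)) z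
  ... | yes z∈xs | _ = z∈xs
  ... | no _ | eq = contradiction (trans (≡-sym eq) ([]=⇒lookup z∈)) λ ()

module _ {n : ℕ} (G : Graph n) where

  private
    variable
      u v w x y z c : Fin n
      vs : List (Fin n)
      P Q : Fin n → Set

  infixr 5 _++ʷ_ _++ⁱ_

  _++ʷ_ : Walk G u v k → Walk G v w l → Walk G u w (k + l)
  here ++ʷ W′ = W′
  step e W ++ʷ W′ = step e (W ++ʷ W′)

  reverseʷ : Walk G u v k → Walk G v u k
  reverseʷ here = here
  reverseʷ {k = suc k} (step e W) =
    subst (Walk G _ _) (+-comm k 1) (reverseʷ W ++ʷ step (sym G e) here)

  splitAtʷ : ∀ i → Walk G u v (i + j) → ∃ λ x → Walk G u x i × Walk G x v j
  splitAtʷ zero W = _ , here , W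
  splitAtʷ (suc i) (step e W) with splitAtʷ i W
  ... | x , W₁ , W₂ = x , step e W₁ , W₂

  _∈ʷ_ : Fin n → Walk G u v k → Set
  _∈ʷ_ {u = u} z here = z ≡ u
  _∈ʷ_ {u = u} z (step e W) = z ≡ u ⊎ z ∈ʷ W

  suffixʷ : (W : Walk G u v k) → z ∈ʷ W → ∃ λ l → l ≤ k × Walk G z v l
  suffixʷ here refl = 0 , z≤n , here
  suffixʷ (step e W) (inj₁ refl) = _ , ≤-refl , step e W
  suffixʷ (step e W) (inj₂ z∈W) with suffixʷ W z∈W
  ... | l , l≤k , W′ = l , m≤n⇒m≤1+n l≤k , W′

  avoid-or-through : ∀ c → Walk G u v k →
    WalkIn G (_≢ c) u v ⊎ ∃₂ λ l₁ l₂ → l₁ + l₂ ≡ k × Walk G u c l₁ × Walk G c v l₂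
  avoid-or-through {u = u} c here with u ≟ c
  ... | yes refl = inj₂ (0 , 0 , refl , here , here)
  ... | no u≢c = inj₁ (here u≢c)
  avoid-or-through {u = u} c (step e W) with u ≟ c
  ... | yes refl = inj₂ (0 , _ , refl , here , step e W)
  ... | no u≢c with avoid-or-through c W
  ...   | inj₁ W′ = inj₁ (step u≢c e W′)
  ...   | inj₂ (l₁ , l₂ , l₁+l₂≡k , W₁ , W₂) =
    inj₂ (suc l₁ , l₂ , cong suc l₁+l₂≡k , step e W₁ , W₂)

  record IsShortest (W : Walk G u v k) : Set where
    constructor shortest
    field
      minimal : ∀ m → Walk G u v m → k ≤ m
  open IsShortest

  shortest-tail : {e : Adj G u w} {W : Walk G w v k} → IsShortest (step e W) → IsShortest W
  shortest-tail {e = e} sh = shortest λ m W′ → ≤-pred (minimal sh (suc m) (step e W′))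

  shortest-∉tail : {e : Adj G u w} {W : Walk G w v k} → IsShortest (step e W) → ¬ u ∈ʷ W
  shortest-∉tail {W = W} sh u∈W with suffixʷ W u∈W
  ... | l , l≤k , W′ = <⇒≱ (s≤s l≤k) (minimal sh l W′)

  module _ {S : Subset n} (cd : ClusterDeletion G S) where

    three-consecutive : {e₁ : Adj G u x} {e₂ : Adj G x y} {W : Walk G y v k} →
      IsShortest (step e₁ (step e₂ W)) → u ∈ S ⊎ x ∈ S ⊎ y ∈ S
    three-consecutive {u = u} {x = x} {y = y} {k = k} {e₁ = e₁} {e₂} {W} sh
      with u ∈? S | x ∈? S | y ∈? S
    ... | yes u∈S | _       | _       = inj₁ u∈S
    ... | no _    | yes x∈S | _       = inj₂ (inj₁ x∈S)
    ... | no _    | no _    | yes y∈S = inj₂ (inj₂ y∈S)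
    ... | no u∉S  | no x∉S  | no y∉S  =
      contradiction (cd u y u∉S y∉S u≢y (step u∉S e₁ (step x∉S e₂ (here y∉S)))) no-chord
      where
      u≢y : u ≢ y
      u≢y refl = 1+n≰n (≤-trans (n≤1+n _) (minimal sh k W))
      no-chord : ¬ Adj G u y
      no-chord e = 1+n≰n (minimal sh (suc k) (step e W))

    record Cover (W : Walk G u v k) : Set where
      constructor cover⟨_,_,_,_⟩
      field
        hits     : Subset n
        hits⊆S   : hits ⊆ S
        hits⊆W   : ∀ {z} → z ∈ hits → z ∈ʷ W
        length≤  : k ≤ 3 * ∣ hits ∣ + 1

    cover-∅ : (W : Walk G u v k) → k ≤ 1 → Cover W
    cover-∅ W k≤1 = cover⟨ ∅ , absurd-∈∅ , absurd-∈∅ , ≤-trans k≤1 (m≤n+m 1 _) ⟩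
      where
      absurd-∈∅ : ∀ {A : Set} {z} → z ∈ ∅ → A
      absurd-∈∅ z∈∅ = contradiction z∈∅ ∉⊥

    cover-singleton : (W : Walk G u v k) → x ∈ S → x ∈ʷ W → k ≤ 4 → Cover W
    cover-singleton {k = k} {x = x} W x∈S x∈W k≤4 =
      cover⟨ ⁅ x ⁆ , (λ z∈ → subst (_∈ S) (≡-sym (x∈⁅y⁆⇒x≡y x z∈)) x∈S) ,
             (λ z∈ → subst (_∈ʷ W) (≡-sym (x∈⁅y⁆⇒x≡y x z∈)) x∈W) ,
             subst (λ s → k ≤ 3 * s + 1) (≡-sym (∣⁅x⁆∣≡1 x)) k≤4 ⟩

    cover-extend : {W : Walk G u v k} {W′ : Walk G w v l} → x ∈ S → x ∈ʷ W → ¬ x ∈ʷ W′ →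
      (∀ {z} → z ∈ʷ W′ → z ∈ʷ W) → k ≤ 3 + l → Cover W′ → Cover W
    cover-extend {k = k} {l = l} {x = x} {W = W}
      x∈S x∈W x∉W′ W′⊆W k≤3+l cover⟨ U , U⊆S , U⊆W′ , l≤ ⟩ =
      cover⟨ ⁅ x ⁆ ∪ U , on-S , on-W , bound ⟩
      where
      ∈-insert⁻ : ∀ {z} → z ∈ ⁅ x ⁆ ∪ U → z ≡ x ⊎ z ∈ U
      ∈-insert⁻ z∈ with x∈p∪q⁻ ⁅ x ⁆ U z∈
      ... | inj₁ z∈⁅x⁆ = inj₁ (x∈⁅y⁆⇒x≡y x z∈⁅x⁆)
      ... | inj₂ z∈U = inj₂ z∈U
      on-S : ⁅ x ⁆ ∪ U ⊆ S
      on-S z∈ with ∈-insert⁻ z∈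
      ... | inj₁ refl = x∈S
      ... | inj₂ z∈U = U⊆S z∈U
      on-W : ∀ {z} → z ∈ ⁅ x ⁆ ∪ U → z ∈ʷ W
      on-W z∈ with ∈-insert⁻ z∈
      ... | inj₁ refl = x∈W
      ... | inj₂ z∈U = W′⊆W (U⊆W′ z∈U)
      U⊂x∪U : U ⊂ ⁅ x ⁆ ∪ U
      U⊂x∪U = q⊆p∪q ⁅ x ⁆ U , x , x∈p∪q⁺ (inj₁ (x∈⁅x⁆ x)) , x∉W′ ∘ U⊆W′
      bound : k ≤ 3 * ∣ ⁅ x ⁆ ∪ U ∣ + 1
      bound = begin
        k                     ≤⟨ k≤3+l ⟩
        3 + l                 ≤⟨ +-monoʳ-≤ 3 l≤ ⟩
        3 + (3 * ∣ U ∣ + 1)   ≡⟨ cong (_+ 1) (≡-sym (*-suc 3 ∣ U ∣)) ⟩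
        3 * suc ∣ U ∣ + 1     ≤⟨ +-monoˡ-≤ 1 (*-monoʳ-≤ 3 (p⊂q⇒∣p∣<∣q∣ U⊂x∪U)) ⟩
        3 * ∣ ⁅ x ⁆ ∪ U ∣ + 1 ∎
        where open ≤-Reasoning

    cover-window : {e₁ : Adj G u x} {e₂ : Adj G x y} {W : Walk G y v k} →
      IsShortest (step e₁ (step e₂ W)) → Cover (step e₂ W) → Cover W →
      (y ∈ S → Cover (step e₁ (step e₂ W))) → Cover (step e₁ (step e₂ W))
    cover-window sh cover₁ cover₂ cover₃ with three-consecutive sh
    ... | inj₁ u∈S = cover-extend u∈S (inj₁ refl) (shortest-∉tail sh) inj₂ (m≤n+m _ 2) cover₁
    ... | inj₂ (inj₁ x∈S) =
      cover-extend x∈S (inj₂ (inj₁ refl)) (shortest-∉tail (shortest-tail sh)) (inj₂ ∘ inj₂)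
        (m≤n+m _ 1) cover₂
    ... | inj₂ (inj₂ y∈S) = cover₃ y∈S

    cover : (W : Walk G u v k) → IsShortest W → Cover W
    cover here _ = cover-∅ here z≤n
    cover (step e here) _ = cover-∅ _ ≤-refl
    cover (step e₁ (step e₂ here)) sh =
      cover-window sh (cover _ (shortest-tail sh)) (cover here (shortest-tail (shortest-tail sh)))
        λ y∈S → cover-singleton _ y∈S (inj₂ (inj₂ refl)) (s≤s (s≤s z≤n))
    cover (step e₁ (step e₂ (step e₃ W))) sh =
      cover-window sh (cover _ sh₁) (cover _ sh₂)
        λ y∈S → cover-extend y∈S (inj₂ (inj₂ (inj₁ refl))) (shortest-∉tail sh₂) (inj₂ ∘ inj₂ ∘ inj₂)
                  ≤-refl (cover W (shortest-tail sh₂))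
      where
      sh₁ : IsShortest (step e₂ (step e₃ W))
      sh₁ = shortest-tail sh
      sh₂ : IsShortest (step e₃ W)
      sh₂ = shortest-tail sh₁

    dist-bound : ∀ {d} → Dist G u v d → d ≤ 3 * ∣ S ∣ + 1
    dist-bound (W , sh) with cover W (shortest sh)
    ... | cover⟨ U , U⊆S , _ , d≤ ⟩ = ≤-trans d≤ (+-monoˡ-≤ 1 (*-monoʳ-≤ 3 (p⊆q⇒∣p∣≤∣q∣ U⊆S)))

  _++ⁱ_ : WalkIn G P u v → WalkIn G P v w → WalkIn G P u w
  here _ ++ⁱ W′ = W′
  step pu e W ++ⁱ W′ = step pu e (W ++ⁱ W′)

  headⁱ : WalkIn G P u v → P u
  headⁱ (here pu) = pu
  headⁱ (step pu _ _) = pu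

  lastⁱ : WalkIn G P u v → P v
  lastⁱ (here pv) = pv
  lastⁱ (step _ _ W) = lastⁱ W

  reverseⁱ : WalkIn G P u v → WalkIn G P v u
  reverseⁱ (here pu) = here pu
  reverseⁱ (step pu e W) = reverseⁱ W ++ⁱ step (headⁱ W) (sym G e) (here pu)

  mapⁱ : (∀ {z} → P z → Q z) → WalkIn G P u v → WalkIn G Q u v
  mapⁱ f (here pu) = here (f pu)
  mapⁱ f (step pu e W) = step (f pu) e (mapⁱ f W)

  connectedIn-via : ∀ h → (∀ z → P z → WalkIn G P z h) → ConnectedIn G P
  connectedIn-via h to-h u v pu pv = to-h u pu ++ⁱ reverseⁱ (to-h v pv)

  data Path : Fin n → Fin n → List (Fin n) → Set where
    single : ∀ u → Path u u (u ∷ [])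
    cons   : Adj G u w → Path w v vs → u ∉ₗ vs → Path u v (u ∷ vs)

  path-head : Path u v vs → u ∈ₗ vs
  path-head (single _) = here refl
  path-head (cons _ _ _) = here refl

  path-last : Path u v vs → v ∈ₗ vs
  path-last (single _) = here refl
  path-last (cons _ p _) = there (path-last p)

  path-walk : Path u v vs → (∀ {t} → t ∈ₗ vs → P t) → WalkIn G P u v
  path-walk (single _) on-P = here (on-P (here refl))
  path-walk (cons e p _) on-P = step (on-P (here refl)) e (path-walk p (on-P ∘ there))

  path-suffix : Path u v vs → z ∈ₗ vs → ∃ λ ws → Path z v ws × ws ⊆ₗ vs
  path-suffix (single _) (here refl) = _ , single _ , id
  path-suffix p@(cons _ _ _) (here refl) = _ , p , id
  path-suffix (cons _ p _) (there z∈vs) with path-suffix p z∈vs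
  ... | ws , q , ws⊆vs = ws , q , there ∘ ws⊆vs

  suffix-walk : Path u v vs → z ∈ₗ vs → (∀ {t} → t ∈ₗ vs → P t) → WalkIn G P z v
  suffix-walk p z∈vs on-P with path-suffix p z∈vs
  ... | _ , q , ws⊆vs = path-walk q (on-P ∘ ws⊆vs)

  PathIn : (Fin n → Set) → Fin n → Fin n → Set
  PathIn P u v = ∃ λ vs → Path u v vs × (∀ {t} → t ∈ₗ vs → P t)

  cons-or-cut : P u → Adj G u w → PathIn P w v → PathIn P u v
  cons-or-cut {u = u} pu e (vs , p , on-P) with u ∈ₗ? vs
  ... | no u∉vs = _ , cons e p u∉vs , λ { (here refl) → pu ; (there t∈vs) → on-P t∈vs }
  ... | yes u∈vs with path-suffix p u∈vs
  ...   | ws , q , ws⊆vs = ws , q , on-P ∘ ws⊆vs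

  loop-erase : WalkIn G P u v → PathIn P u v
  loop-erase (here pu) = _ , single _ , λ { (here refl) → pu }
  loop-erase (step pu e W) = cons-or-cut pu e (loop-erase W)

  -- Since w occurs at most once on a path, one of the two ends is reachable from z avoiding w.
  path-escape : Path u v vs → z ∈ₗ vs → z ≢ w →
    WalkIn G (λ t → t ∈ₗ vs × t ≢ w) z v ⊎ WalkIn G (λ t → t ∈ₗ vs × t ≢ w) z u
  path-escape (single _) (here refl) z≢w = inj₁ (here (here refl , z≢w))
  path-escape {w = w} p@(cons {vs = vs} _ _ _) (here refl) u≢w with w ∈ₗ? vs
  ... | yes _ = inj₂ (here (here refl , u≢w))
  ... | no w∉vs = inj₁ (path-walk p λ t∈ → t∈ , λ { refl → w∉u∷vs t∈ })
    where
    w∉u∷vs : w ∉ₗ _ ∷ vs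
    w∉u∷vs (here w≡u) = u≢w (≡-sym w≡u)
    w∉u∷vs (there w∈vs) = w∉vs w∈vs
  path-escape {u = u} {w = w} (cons e p u∉vs) (there z∈vs) z≢w with path-escape p z∈vs z≢w | u ≟ w
  ... | inj₁ W | _ = inj₁ (mapⁱ (map₁ there) W)
  ... | inj₂ _ | yes refl =
    inj₁ (mapⁱ (map₁ there) (suffix-walk p z∈vs λ t∈ → t∈ , λ { refl → u∉vs t∈ }))
  ... | inj₂ W | no u≢w =
    inj₂ (mapⁱ (map₁ there) W ++ⁱ step (map₁ there (lastⁱ W)) (sym G e) (here (here refl , u≢w)))

  cycle-nonseparable : Adj G c x → Adj G c y → Path x y vs → c ∉ₗ vs →
    NonSeparable G (fromList (c ∷ vs))
  cycle-nonseparable {c = c} {vs = vs} cx cy p c∉vs = connectedIn-via c to-c , without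
    where
    B : Subset n
    B = fromList (c ∷ vs)
    c∈B : c ∈ B
    c∈B = ∈-fromList⁺ (c ∷ vs) (here refl)
    inB : ∀ {t} → t ∈ₗ vs → t ∈ B
    inB = ∈-fromList⁺ (c ∷ vs) ∘ there
    B⊆c∷vs : ∀ {t} → t ∈ B → t ∈ₗ c ∷ vs
    B⊆c∷vs = ∈-fromList⁻ (c ∷ vs)
    to-c : ∀ z → z ∈ B → WalkIn G (_∈ B) z c
    to-c z z∈B with B⊆c∷vs z∈B
    ... | here refl = here c∈B
    ... | there z∈vs = suffix-walk p z∈vs inB ++ⁱ step (inB (path-last p)) (sym G cy) (here c∈B)
    without : ∀ w → w ∈ B → ConnectedIn G (λ t → t ∈ B × t ≢ w)
    without w _ with w ≟ c
    ... | yes refl = connectedIn-via _ to-end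
      where
      to-end : ∀ z → z ∈ B × z ≢ c → WalkIn G (λ t → t ∈ B × t ≢ c) z _
      to-end z (z∈B , z≢c) with B⊆c∷vs z∈B
      ... | here refl = contradiction refl z≢c
      ... | there z∈vs = suffix-walk p z∈vs λ t∈ → inB t∈ , λ { refl → c∉vs t∈ }
    ... | no w≢c = connectedIn-via c to-c′
      where
      c′ : c ∈ B × c ≢ w
      c′ = c∈B , ≢-sym w≢c
      to-c′ : ∀ z → z ∈ B × z ≢ w → WalkIn G (λ t → t ∈ B × t ≢ w) z c
      to-c′ z (z∈B , z≢w) with B⊆c∷vs z∈B
      ... | here refl = here c′
      ... | there z∈vs with path-escape p z∈vs z≢w
      ...   | inj₁ W = mapⁱ (map₁ inB) W ++ⁱ step (map₁ inB (lastⁱ W)) (sym G cy) (here c′)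
      ...   | inj₂ W = mapⁱ (map₁ inB) W ++ⁱ step (map₁ inB (lastⁱ W)) (sym G cx) (here c′)

  BlockAbove : Subset n → Set
  BlockAbove B = ∃ λ B* → Block G B* × B ⊆ B*

  open WF.All (⊃-wellFounded {n}) 0ℓ renaming (wfRec to ⊃-rec)

  -- By ⊃-induction: were no block to contain B, B would itself be maximal, as every strictly larger
  -- non-separable set lies in a block.
  extend-to-block : ∀ B → NonSeparable G B → ¬ ¬ BlockAbove B
  extend-to-block = ⊃-rec _ λ B ih nsB none → none (B , (nsB , maximal B ih none) , id)
    where
    maximal : ∀ B → (∀ {B′} → B′ ⊃ B → NonSeparable G B′ → ¬ ¬ BlockAbove B′) → ¬ BlockAbove B →
      ∀ B′ → B ⊆ B′ → NonSeparable G B′ → B′ ⊆ B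
    maximal B ih none B′ B⊆B′ nsB′ {x} x∈B′ with x ∈? B
    ... | yes x∈B = x∈B
    ... | no x∉B = contradiction (λ (B* , blk , B′⊆B*) → none (B* , blk , B′⊆B* ∘ B⊆B′))
                     (ih (B⊆B′ , x , x∈B′ , x∉B) nsB′)

  neighbours-adjacent : BlockGraph G → Adj G c x → Adj G c y → x ≢ y → WalkIn G (_≢ c) x y →
    ¬ ¬ Adj G x y
  neighbours-adjacent {c = c} {x = x} {y = y} bg cx cy x≢y W with loop-erase W
  ... | vs , p , avoids-c =
    ¬¬-map clique (extend-to-block _ (cycle-nonseparable cx cy p λ c∈vs → avoids-c c∈vs refl))
    where
    inB : ∀ {t} → t ∈ₗ vs → t ∈ fromList (c ∷ vs)
    inB = ∈-fromList⁺ (c ∷ vs) ∘ there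
    clique : BlockAbove (fromList (c ∷ vs)) → Adj G x y
    clique (B* , blk , B⊆B*) = bg B* blk x y (B⊆B* (inB (path-head p))) (B⊆B* (inB (path-last p))) x≢y

  module Distances (δ : ∀ u v → ∃ (Dist G u v)) where

    dist : Fin n → Fin n → ℕ
    dist u v = proj₁ (δ u v)

    geodesic : ∀ u v → Walk G u v (dist u v)
    geodesic u v = proj₁ (proj₂ (δ u v))

    dist-minimal : Walk G u v k → dist u v ≤ k
    dist-minimal = proj₂ (proj₂ (δ _ _)) _

    dist-sym : dist u v ≡ dist v u
    dist-sym = ≤-antisym (dist-minimal (reverseʷ (geodesic _ _)))
                         (dist-minimal (reverseʷ (geodesic _ _)))

    dist-triangle : dist u w ≤ dist u v + dist v w
    dist-triangle {u = u} {w = w} {v = v} = dist-minimal (geodesic u v ++ʷ geodesic v w)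

    dist-on-geodesic : dist u w ≡ i + j → dist u v ≤ i → dist v w ≤ j → i ≤ dist u v × j ≤ dist v w
    dist-on-geodesic {u = u} {w = w} {i = i} {j = j} {v = v} d≡ uv≤ vw≤ =
      +-cancelʳ-≤ j i (dist u v) (≤-trans i+j≤ (+-monoʳ-≤ (dist u v) vw≤)) ,
      +-cancelˡ-≤ i j (dist v w) (≤-trans i+j≤ (+-monoˡ-≤ (dist v w) uv≤))
      where
      i+j≤ : i + j ≤ dist u v + dist v w
      i+j≤ = subst (_≤ dist u v + dist v w) d≡ dist-triangle

    avoids : ∀ c → (W : Walk G u v k) → k < dist u c + dist c v → WalkIn G (_≢ c) u v
    avoids c W k< with avoid-or-through c W
    ... | inj₁ W′ = W′
    ... | inj₂ (l₁ , l₂ , refl , W₁ , W₂) =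
      contradiction (+-mono-≤ (dist-minimal W₁) (dist-minimal W₂)) (<⇒≱ k<)

    shorter-than-dist : Walk G u v k → ¬ k < dist u v
    shorter-than-dist W k< = <⇒≱ k< (dist-minimal W)

    farthest : Fin n → Fin n
    farthest u = argmaxᶠ (dist u) u

    eccentricity : Fin n → ℕ
    eccentricity u = dist u (farthest u)

    dist≤eccentricity : ∀ u v → dist u v ≤ eccentricity u
    dist≤eccentricity u v = f≤f[argmaxᶠ] (dist u) u v

    eccentricity-Ecc : ∀ u → Ecc G u (eccentricity u)
    eccentricity-Ecc u =
      (λ v → dist u v , proj₂ (δ u v) , dist≤eccentricity u v) ,
      farthest u , proj₂ (δ u (farthest u))

    diametral-pair : Fin n → ∃₂ λ a b → ∀ u v → dist u v ≤ dist a b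
    diametral-pair u₀ =
      a , farthest a , λ u v → ≤-trans (dist≤eccentricity u v) (f≤f[argmaxᶠ] eccentricity u₀ u)
      where
      a : Fin n
      a = argmaxᶠ eccentricity u₀

    module _ (bg : BlockGraph G) {a b : Fin n} (diametral : ∀ u v → dist u v ≤ dist a b) where

      -- A farther vertex v would close a cycle x ⇝ a ⇝ v ⇝ b ⇝ y around c, forcing the chord xy.
      central : (P : Walk G a x i) (e₁ : Adj G x c) (e₂ : Adj G c y) (Q : Walk G y b j) →
        i ≤ j → dist a b ≡ suc i + suc j → ∀ v → dist c v ≤ suc j
      central {x = x} {i = i} {c = c} {y = y} {j = j} P e₁ e₂ Q i≤j D≡ v =
        decidable-stable (dist c v ≤? suc j) λ far →
          neighbours-adjacent bg (sym G e₁) e₂ x≢y (around (≰⇒> far)) no-chord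
        where
        a-c≤ : dist a c ≤ suc i
        a-c≤ = ≤-trans (dist-minimal (P ++ʷ step e₁ here)) (≤-reflexive (+-comm i 1))
        a-c-b : suc i ≤ dist a c × suc j ≤ dist c b
        a-c-b = dist-on-geodesic D≡ a-c≤ (dist-minimal (step e₂ Q))
        i<a-c : i < dist a c
        i<a-c = proj₁ a-c-b
        j<c-b : j < dist c b
        j<c-b = proj₂ a-c-b
        x≢y : x ≢ y
        x≢y refl = shorter-than-dist (P ++ʷ Q)
          (subst (i + j <_) (≡-sym D≡) (s≤s (+-monoʳ-≤ i (n≤1+n j))))
        no-chord : ¬ Adj G x y
        no-chord e = shorter-than-dist (P ++ʷ step e Q) (subst (i + suc j <_) (≡-sym D≡) ≤-refl)
        around : suc j < dist c v → WalkIn G (_≢ c) x y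
        around far =
          reverseⁱ (avoids c P (<-≤-trans i<a-c (m≤m+n _ _))) ++ⁱ
          avoids c (geodesic a v) a-v< ++ⁱ
          avoids c (geodesic v b) v-b< ++ⁱ
          reverseⁱ (avoids c Q (<-≤-trans j<c-b (m≤n+m _ _)))
          where
          open ≤-Reasoning
          a-v< : dist a v < dist a c + dist c v
          a-v< = begin-strict
            dist a v          ≤⟨ diametral a v ⟩
            dist a b          ≡⟨ D≡ ⟩
            suc i + suc j     <⟨ +-monoʳ-< (suc i) far ⟩
            suc i + dist c v  ≤⟨ +-monoˡ-≤ (dist c v) i<a-c ⟩
            dist a c + dist c v ∎
          v-b< : dist v b < dist v c + dist c b
          v-b< = begin-strict
            dist v b          ≤⟨ diametral v b ⟩
            dist a b          ≡⟨ D≡ ⟩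
            suc i + suc j     ≤⟨ +-monoˡ-≤ (suc j) (s≤s i≤j) ⟩
            suc j + suc j     <⟨ +-monoˡ-< (suc j) far ⟩
            dist c v + suc j  ≤⟨ +-mono-≤ (≤-reflexive dist-sym) j<c-b ⟩
            dist v c + dist c b ∎

      center-at : dist a b ≡ suc i + suc j → i ≤ j → j ≤ suc i →
        ∃ λ c → ∀ v → 2 * dist c v ≤ suc (dist a b)
      center-at {i = i} {j = j} D≡ i≤j j≤1+i
        with splitAtʷ i (subst (Walk G a b) (trans D≡ (≡-sym (+-suc i (suc j)))) (geodesic a b))
      ... | _ , P , step {w = c} e₁ (step e₂ Q) = c , λ v → begin
        2 * dist c v           ≤⟨ *-monoʳ-≤ 2 (central P e₁ e₂ Q i≤j D≡ v) ⟩
        suc j + (suc j + 0)    ≡⟨ cong (suc j +_) (+-identityʳ (suc j)) ⟩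
        suc j + suc j          ≤⟨ +-monoˡ-≤ (suc j) (s≤s j≤1+i) ⟩
        suc (suc i) + suc j    ≡⟨ cong suc (≡-sym D≡) ⟩
        suc (dist a b)         ∎
        where open ≤-Reasoning

      center : ∃ λ c → ∀ v → 2 * dist c v ≤ suc (dist a b)
      center = center-of (dist a b) refl
        where
        center-of : ∀ D → dist a b ≡ D → ∃ λ c → ∀ v → 2 * dist c v ≤ suc (dist a b)
        center-of zero D≡ = a , λ v → twice≤suc (diametral a v) (≤-trans (≤-reflexive D≡) z≤n)
        center-of (suc zero) D≡ = a , λ v → twice≤suc (diametral a v) (≤-reflexive D≡)
        center-of (suc (suc D′)) D≡ with halve D′
        ... | i , j , i+j≡D′ , i≤j , j≤1+i =
          center-at (trans D≡ (cong suc (≡-sym (trans (+-suc i j) (cong suc i+j≡D′))))) i≤j j≤1+i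

    radius-vs-diameter : BlockGraph G → ∀ {r} → Radius G r → ∃₂ λ a b → 2 * r ≤ suc (dist a b)
    radius-vs-diameter bg ((u₀ , _) , r-least) =
      let a , b , diametral = diametral-pair u₀
          c₀ , c₀-central   = center bg diametral
      in a , b , ≤-trans (*-monoʳ-≤ 2 (r-least c₀ (eccentricity c₀) (eccentricity-Ecc c₀)))
                         (c₀-central (farthest c₀))

all-distances : (G : Graph n) → Connected G → ¬ ¬ (∀ u v → ∃ (Dist G u v))
all-distances G conn = ¬¬-∀ λ u → ¬¬-∀ λ v → ¬¬-least (proj₂ (conn u v))

theorem9 : ∀ {n : ℕ} (G : Graph n) → Connected G → BlockGraph G →
    ∀ (r k : ℕ) → Radius G r → DistToCluster G k → 2 * r ≤ 3 * k + 2
theorem9 G conn bg r k rad ((S , S-cd , ∣S∣≡k) , _) =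
  decidable-stable (2 * r ≤? 3 * k + 2) (bound <$> all-distances G conn)
  where
  bound : (∀ u v → ∃ (Dist G u v)) → 2 * r ≤ 3 * k + 2
  bound δ =
    let a , b , 2r≤1+dab = Distances.radius-vs-diameter G δ bg rad in
    begin
      2 * r                ≤⟨ 2r≤1+dab ⟩
      suc (proj₁ (δ a b))  ≤⟨ s≤s (dist-bound G S-cd (proj₂ (δ a b))) ⟩
      suc (3 * ∣ S ∣ + 1)  ≡⟨ cong (λ s → suc (3 * s + 1)) ∣S∣≡k ⟩
      suc (3 * k + 1)      ≡⟨ ≡-sym (+-suc (3 * k) 1) ⟩
      3 * k + 2            ∎
    where open ≤-Reasoning
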